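{- Let $G$ be a banana path with vertices $v_0,\ldots,v_n$, and let $0\le k$, $\ell\ge0$ with $k+\ell\le n$. Let $a_1,\ldots,a_s$ be positive integers such that for each $1\le i\le \ell$ the number of edges between $v_{k+i-1}$ and $v_{k+i}$ equals $a_j$, where $j\in\{1,\ldots,s\}$ and $j\equiv i\pmod s$. Let $L=\operatorname{lcm}(a_1,\ldots,a_s)$ and suppose $\ell+1\ge sL^2$. If $D$ is a divisor on $G$ of positive rank, then some effective divisor equivalent to $D$ places at least $L$ chips in total on the vertices $v_k,\ldots,v_{k+\ell}$.
   Context: Graphs are finite, connected, loopless multigraphs. A banana path is a multigraph with vertices $v_0,\ldots,v_n$ in which $v_i,v_j$ are joined by at least one edge iff $|i-j|=1$. For vertices $v,w$, $|E(v,w)|$ is the number of edges joining them and $\mathrm{val}(v)$ the number of edges at $v$. A divisor is $D:V\to\mathbb{Z}$, effective if nonnegative; $D(v)$ is the number of chips on $v$. Firing $v$ changes $D$ to $D'$ with $D'(v)=D(v)-\mathrm{val}(v)$, $D'(w)=D(w)+|E(v,w)|$ for $w\ne v$; $D\sim D'$ if related by finitely many firings. The rank $r(D)$ is $-1$ if $D$ is equivalent to no effective divisor, else the largest $r\ge0$ such that $D-E$ is equivalent to an effective divisor for every effective $E$ of degree $r$. -}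

module Defs where

open import Data.Nat as ℕ using (ℕ; zero; suc; _<_; _<?_)
open import Data.Nat.LCM using (lcm)
open import Data.Fin as Fin using (Fin; toℕ; fromℕ<)
open import Data.Integer as ℤ using (ℤ; +_; _-_; 0ℤ)
open import Data.List using (List; foldr; map; allFin)
open import Data.Product using (Σ; _×_)
open import Relation.Nullary using (yes; no)
open import Relation.Binary.PropositionalEquality using (_≡_)
open import Relation.Binary.Construct.Closure.ReflexiveTransitive using (Star)
open import Data.Sum using (_⊎_)

-- A banana path with vertices v_0,...,v_n is given by n and the edge
-- multiplicities  m : Fin n → ℕ, where m i = |E(v_i, v_{i+1})| ≥ 1.
-- Vertices are Fin (suc n); vertex v_i is the element with toℕ = i.

extMult : {n : ℕ} → (Fin n → ℕ) → ℕ → ℕ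
extMult {n} m i with i <? n
... | yes i<n = m (fromℕ< i<n)
... | no _ = 0

E : {n : ℕ} → (Fin n → ℕ) → Fin (suc n) → Fin (suc n) → ℕ
E m v w with toℕ w ℕ.≟ suc (toℕ v)
... | yes _ = extMult m (toℕ v)
... | no _ with toℕ v ℕ.≟ suc (toℕ w)
...   | yes _ = extMult m (toℕ w)
...   | no _ = 0

sumℕ : List ℕ → ℕ
sumℕ = foldr ℕ._+_ 0

sumℤ : List ℤ → ℤ
sumℤ = foldr ℤ._+_ 0ℤ

val : {n : ℕ} → (Fin n → ℕ) → Fin (suc n) → ℕ
val {n} m v = sumℕ (map (E m v) (allFin (suc n)))

Divisor : ℕ → Set
Divisor n = Fin (suc n) → ℤ

Effective : {n : ℕ} → Divisor n → Set
Effective D = ∀ v → 0ℤ ℤ.≤ D v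

deg : {n : ℕ} → Divisor n → ℤ
deg {n} D = sumℤ (map D (allFin (suc n)))

fire : {n : ℕ} → (Fin n → ℕ) → Divisor n → Fin (suc n) → Divisor n
fire m D v w with v Fin.≟ w
... | yes _ = D w - + val m v
... | no _ = D w ℤ.+ + E m v w

FireStep : {n : ℕ} → (Fin n → ℕ) → Divisor n → Divisor n → Set
FireStep m D D' = Σ _ λ v → (∀ w → D' w ≡ fire m D v w) ⊎ (∀ w → D w ≡ fire m D' v w)

Equiv : {n : ℕ} → (Fin n → ℕ) → Divisor n → Divisor n → Set
Equiv m = Star (FireStep m)

RankAtLeast : {n : ℕ} → (Fin n → ℕ) → Divisor n → ℕ → Set
RankAtLeast {n} m D r =
  (F : Divisor n) → Effective F → deg F ≡ + r →
  Σ (Divisor n) λ D' → Equiv m (λ v → D v - F v) D' × Effective D'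

lcmAll : (s : ℕ) → (Fin s → ℕ) → ℕ
lcmAll zero a = 1
lcmAll (suc s) a = lcm (a Fin.zero) (lcmAll s (λ i → a (Fin.suc i)))

chipsOn : {n : ℕ} → Divisor n → ℕ → ℕ → ℤ
chipsOn {n} D k ℓ = sumℤ (map f (allFin (suc n)))
  where
  f : Fin (suc n) → ℤ
  f v with k ℕ.≤? toℕ v | toℕ v ℕ.≤? k ℕ.+ ℓ
  ... | yes _ | yes _ = D v
  ... | _ | _ = 0ℤ

-- Encode a divisor D by its prefix sums  prefix D u = D(v₀) + ⋯ + D(v_{u-1}),  and write
-- crossing u for the number of edges between v_{u-1} and v_u.  Firing v_a changes prefix D
-- only at u = a and u = a + 1, by ± crossing u, and firing v₀, …, v_{u-1} changes it only at u.
-- Hence the effective divisors equivalent to D correspond to the nondecreasing sequences R with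
-- R u ≡ prefix D u (mod crossing u).  Among these there is a least one (lowest, built greedily
-- from the left) and a greatest one (highest, built greedily from the right); following lowest up
-- to k and highest after k yields an equivalent effective divisor with
-- highest (k+ℓ+1) − lowest k chips on v_k, …, v_{k+ℓ}.  Positive rank provides, for every j, an
-- admissible R with R (j+1) ≥ R j + 1, so lowest j + 1 ≤ highest (j+1).  If fewer than L chips
-- remained, lowest + highest would have to increase on each of the L² − 1 aligned blocks of s
-- consecutive cuts in the window: if both stalled on a block, their difference there would be
-- positive and, by periodicity, divisible by every aᵢ, hence at least L.  But lowest + highest
-- can increase by at most 2(L − 1) over the window, which is less than L² − 1.

module Submission where

module IntegerSequences where

  open import Defs using (sumℕ; sumℤ; lcmAll)
  open import Data.Nat as ℕ using (ℕ; zero; suc; z≤n; s≤s; NonZero)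
  import Data.Nat.Properties as ℕₚ
  open import Data.Nat.DivMod using (_mod_; _%_; m<n⇒m%n≡m; [m+kn]%n≡m%n)
  open import Data.Nat.Divisibility using (∣⇒≤; 1∣_) renaming (_∣_ to _∣ℕ_)
  open import Data.Nat.LCM using (lcm-least)
  open import Data.Integer as ℤ using (ℤ; +_; -[1+_]; 0ℤ; 1ℤ; _+_; _-_; -_; _*_; _≤_; _<_)
  import Data.Integer.Properties as ℤₚ
  open import Data.Integer.DivMod using (_%ℕ_; _/ℕ_; a≡a%ℕn+[a/ℕn]*n; n%ℕd<d)
  open import Data.Integer.Divisibility.Signed using (_∣_; divides; ∣m⇒∣-m; ∣m∣n⇒∣m+n; ∣⇒∣ᵤ)
  open import Data.Integer.Tactic.RingSolver using (solve-∀)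
  open import Data.Fin as Fin using (Fin; toℕ)
  import Data.Fin.Properties as Finₚ
  open import Data.List using ([]; _∷_; map; tabulate; allFin)
  import Data.List.Properties as Listₚ
  open import Data.Product using (_×_; _,_; proj₁; proj₂)
  open import Data.Sum using (inj₁; inj₂)
  open import Data.Empty using (⊥; ⊥-elim)
  open import Function using (_∘_; id)
  open import Relation.Nullary using (yes; no)
  open import Relation.Binary.Definitions using (tri<; tri≈; tri>)
  open import Relation.Binary.PropositionalEquality

  prefixSum : (ℕ → ℤ) → ℕ → ℤ
  prefixSum f zero    = 0ℤ
  prefixSum f (suc N) = prefixSum f N + f N

  prefixSum-cong : ∀ {f g} N → (∀ i → i ℕ.< N → f i ≡ g i) → prefixSum f N ≡ prefixSum g N
  prefixSum-cong zero    f≡g = refl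
  prefixSum-cong (suc N) f≡g =
    cong₂ _+_ (prefixSum-cong N (λ i i<N → f≡g i (ℕₚ.m<n⇒m<1+n i<N))) (f≡g N ℕₚ.≤-refl)

  prefixSum-+ : ∀ f g N → prefixSum (λ i → f i + g i) N ≡ prefixSum f N + prefixSum g N
  prefixSum-+ f g zero    = refl
  prefixSum-+ f g (suc N) =
    trans (cong (_+ (f N + g N)) (prefixSum-+ f g N)) (interchange (prefixSum f N) (prefixSum g N) (f N) (g N))
    where
    interchange : ∀ a b c d → (a + b) + (c + d) ≡ (a + c) + (b + d)
    interchange = solve-∀

  prefixSum-minus : ∀ f g N → prefixSum (λ i → f i - g i) N ≡ prefixSum f N - prefixSum g N
  prefixSum-minus f g zero    = refl
  prefixSum-minus f g (suc N) =
    trans (cong (_+ (f N - g N)) (prefixSum-minus f g N)) (interchange (prefixSum f N) (prefixSum g N) (f N) (g N))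
    where
    interchange : ∀ a b c d → (a - b) + (c - d) ≡ (a + c) - (b + d)
    interchange = solve-∀

  prefixSum-telescope : ∀ (g : ℕ → ℤ) N → prefixSum (λ i → g (suc i) - g i) N ≡ g N - g 0
  prefixSum-telescope g zero    = sym (ℤₚ.+-inverseʳ (g 0))
  prefixSum-telescope g (suc N) = begin
    prefixSum (λ i → g (suc i) - g i) N + (g (suc N) - g N) ≡⟨ cong (_+ (g (suc N) - g N)) (prefixSum-telescope g N) ⟩
    (g N - g 0) + (g (suc N) - g N)                          ≡⟨ ℤₚ.+-comm (g N - g 0) (g (suc N) - g N) ⟩
    (g (suc N) - g N) + (g N - g 0)                          ≡⟨ ℤₚ.+-minus-telescope (g (suc N)) (g N) (g 0) ⟩
    g (suc N) - g 0                                          ∎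
    where open ≡-Reasoning

  prefixSum-front : ∀ f N → prefixSum f (suc N) ≡ f 0 + prefixSum (f ∘ suc) N
  prefixSum-front f zero    = ℤₚ.+-comm 0ℤ (f 0)
  prefixSum-front f (suc N) = trans (cong (_+ f (suc N)) (prefixSum-front f N)) (ℤₚ.+-assoc (f 0) _ _)

  sumℤ-tabulate : ∀ {N} {f : Fin N → ℤ} {g : ℕ → ℤ} → (∀ w → f w ≡ g (toℕ w)) →
                  sumℤ (tabulate f) ≡ prefixSum g N
  sumℤ-tabulate {zero}          f≡g = refl
  sumℤ-tabulate {suc N} {g = g} f≡g =
    trans (cong₂ _+_ (f≡g Fin.zero) (sumℤ-tabulate (f≡g ∘ Fin.suc))) (sym (prefixSum-front g N))

  sumℤ-allFin : ∀ {N} {f : Fin N → ℤ} {g : ℕ → ℤ} → (∀ w → f w ≡ g (toℕ w)) →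
                sumℤ (map f (allFin N)) ≡ prefixSum g N
  sumℤ-allFin {f = f} f≡g = trans (cong sumℤ (Listₚ.map-tabulate id f)) (sumℤ-tabulate f≡g)

  pos-sumℕ : ∀ {A : Set} (f : A → ℕ) xs → + sumℕ (map f xs) ≡ sumℤ (map (+_ ∘ f) xs)
  pos-sumℕ f []       = refl
  pos-sumℕ f (x ∷ xs) = cong (_+_ (+ f x)) (pos-sumℕ f xs)

  spike : ℕ → ℤ → ℕ → ℤ
  spike j c i with i ℕ.≟ j
  ... | yes _ = c
  ... | no  _ = 0ℤ

  spike-self : ∀ j c → spike j c j ≡ c
  spike-self j c with j ℕ.≟ j
  ... | yes _   = refl
  ... | no  j≢j = ⊥-elim (j≢j refl)

  spike-other : ∀ {j i} c → i ≢ j → spike j c i ≡ 0ℤ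
  spike-other {j} {i} c i≢j with i ℕ.≟ j
  ... | yes i≡j = ⊥-elim (i≢j i≡j)
  ... | no  _   = refl

  step : ℕ → ℤ → ℕ → ℤ
  step j c u with j ℕ.<? u
  ... | yes _ = c
  ... | no  _ = 0ℤ

  step-< : ∀ {j u} c → j ℕ.< u → step j c u ≡ c
  step-< {j} {u} c j<u with j ℕ.<? u
  ... | yes _   = refl
  ... | no  j≮u = ⊥-elim (j≮u j<u)

  step-≥ : ∀ {j u} c → u ℕ.≤ j → step j c u ≡ 0ℤ
  step-≥ {j} {u} c u≤j with j ℕ.<? u
  ... | yes j<u = ⊥-elim (ℕₚ.<⇒≱ j<u u≤j)
  ... | no  _   = refl

  step-saturated : ∀ {j u} c → (u ℕ.≤ j → c ≡ 0ℤ) → step j c u ≡ c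
  step-saturated {j} {u} c vanishes with j ℕ.<? u
  ... | yes _   = refl
  ... | no  j≮u = sym (vanishes (ℕₚ.≮⇒≥ j≮u))

  step-suc : ∀ j c u → step j c (suc u) - step j c u ≡ spike j c u
  step-suc j c u with ℕₚ.<-cmp u j
  ... | tri< u<j _ _ = begin
    step j c (suc u) - step j c u ≡⟨ cong₂ _-_ (step-≥ c u<j) (step-≥ c (ℕₚ.<⇒≤ u<j)) ⟩
    0ℤ                            ≡⟨ spike-other c (ℕₚ.<⇒≢ u<j) ⟨
    spike j c u                   ∎
    where open ≡-Reasoning
  ... | tri≈ _ refl _ = begin
    step j c (suc j) - step j c j ≡⟨ cong₂ _-_ (step-< c (ℕₚ.n<1+n j)) (step-≥ c ℕₚ.≤-refl) ⟩
    c - 0ℤ                        ≡⟨ ℤₚ.+-identityʳ c ⟩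
    c                             ≡⟨ spike-self j c ⟨
    spike j c j                   ∎
    where open ≡-Reasoning
  ... | tri> _ _ j<u = begin
    step j c (suc u) - step j c u ≡⟨ cong₂ _-_ (step-< c (ℕₚ.m<n⇒m<1+n j<u)) (step-< c j<u) ⟩
    c - c                         ≡⟨ ℤₚ.+-inverseʳ c ⟩
    0ℤ                            ≡⟨ spike-other c (ℕₚ.>⇒≢ j<u) ⟨
    spike j c u                   ∎
    where open ≡-Reasoning

  prefixSum-spike : ∀ j c N → prefixSum (spike j c) N ≡ step j c N
  prefixSum-spike j c N = begin
    prefixSum (spike j c) N                                  ≡⟨ prefixSum-cong N (λ i _ → sym (step-suc j c i)) ⟩
    prefixSum (λ i → step j c (suc i) - step j c i) N        ≡⟨ prefixSum-telescope (step j c) N ⟩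
    step j c N - step j c 0                                  ≡⟨ ℤₚ.+-identityʳ (step j c N) ⟩
    step j c N                                               ∎
    where open ≡-Reasoning

  prefixSum-below : ∀ h {b} N → b ℕ.≤ N → prefixSum (λ i → step i (h i) b) N ≡ prefixSum h b
  prefixSum-below h {b} zero z≤n = refl
  prefixSum-below h {b} (suc N) b≤1+N with ℕₚ.m≤n⇒m<n∨m≡n b≤1+N
  ... | inj₁ b<1+N = begin
    prefixSum (λ i → step i (h i) b) N + step N (h N) b ≡⟨ cong₂ _+_ (prefixSum-below h N b≤N) (step-≥ (h N) b≤N) ⟩
    prefixSum h b + 0ℤ                                  ≡⟨ ℤₚ.+-identityʳ _ ⟩
    prefixSum h b                                       ∎
    where
    open ≡-Reasoning
    b≤N = ℕ.s≤s⁻¹ b<1+N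
  ... | inj₂ refl = prefixSum-cong (suc N) (λ i i<b → step-< (h i) i<b)

  infix 4 _≡[mod_]_

  record _≡[mod_]_ (x : ℤ) (μ : ℕ) (y : ℤ) : Set where
    constructor ≡-mod
    field
      ∣difference : + μ ∣ y - x

  ≡-mod-refl : ∀ {μ} x → x ≡[mod μ ] x
  ≡-mod-refl x = ≡-mod (divides 0ℤ (ℤₚ.+-inverseʳ x))

  ≡-mod-reflexive : ∀ {μ x y} → x ≡ y → x ≡[mod μ ] y
  ≡-mod-reflexive {x = x} refl = ≡-mod-refl x

  ≡-mod-sym : ∀ {μ x y} → x ≡[mod μ ] y → y ≡[mod μ ] x
  ≡-mod-sym {μ} {x} {y} (≡-mod μ∣y-x) = ≡-mod (subst (+ μ ∣_) (negate-difference y x) (∣m⇒∣-m μ∣y-x))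
    where
    negate-difference : ∀ a b → - (a - b) ≡ b - a
    negate-difference = solve-∀

  ≡-mod-trans : ∀ {μ x y z} → x ≡[mod μ ] y → y ≡[mod μ ] z → x ≡[mod μ ] z
  ≡-mod-trans {μ} {x} {y} {z} (≡-mod μ∣y-x) (≡-mod μ∣z-y) =
    ≡-mod (subst (+ μ ∣_) (ℤₚ.+-minus-telescope z y x) (∣m∣n⇒∣m+n μ∣z-y μ∣y-x))

  ≡-mod-neg : ∀ {μ x y} → x ≡[mod μ ] y → - x ≡[mod μ ] - y
  ≡-mod-neg {μ} {x} {y} (≡-mod μ∣y-x) = ≡-mod (subst (+ μ ∣_) (negate-difference x y) (∣m⇒∣-m μ∣y-x))
    where
    negate-difference : ∀ a b → - (b - a) ≡ - b - - a
    negate-difference = solve-∀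

  ≡-mod-+ʳ : ∀ {μ x y} z → x ≡[mod μ ] y → x + z ≡[mod μ ] y + z
  ≡-mod-+ʳ {μ} {x} {y} z (≡-mod μ∣y-x) = ≡-mod (subst (+ μ ∣_) (cancel x y z) μ∣y-x)
    where
    cancel : ∀ a b d → b - a ≡ (b + d) - (a + d)
    cancel = solve-∀

  ≡-mod-0⇒≡ : ∀ {x y} → x ≡[mod 0 ] y → x ≡ y
  ≡-mod-0⇒≡ {x} {y} (≡-mod (divides q y-x≡q*0)) =
    sym (ℤₚ.i-j≡0⇒i≡j y x (trans y-x≡q*0 (ℤₚ.*-zeroʳ q)))

  ≡-mod-shift : ∀ {μ x x' f} → x' ≡ x + f → + μ ∣ f → x ≡[mod μ ] x'
  ≡-mod-shift {μ} {x} {x'} {f} refl μ∣f = ≡-mod (subst (+ μ ∣_) (cancel x f) μ∣f)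
    where
    cancel : ∀ a b → b ≡ (a + b) - a
    cancel = solve-∀

  nonneg-multiple : ∀ {μ z} → + μ ∣ z → - + μ < z → 0ℤ ≤ z
  nonneg-multiple {μ} (divides (+ k) refl) _ = ℤₚ.≤-trans (ℤ.+≤+ z≤n) (ℤₚ.≤-reflexive (ℤₚ.pos-* k μ))
  nonneg-multiple {μ} (divides -[1+ k ] refl) -μ<z = ⊥-elim (ℤₚ.<⇒≱ -μ<z z≤-μ)
    where
    z≤-μ : -[1+ k ] * + μ ≤ - + μ
    z≤-μ = begin
      -[1+ k ] * + μ        ≡⟨ ℤₚ.neg-distribˡ-* (+ suc k) (+ μ) ⟨
      - (+ suc k * + μ)     ≡⟨ cong -_ (ℤₚ.pos-* (suc k) μ) ⟨
      - + (suc k ℕ.* μ)     ≤⟨ ℤₚ.neg-mono-≤ (ℤ.+≤+ (ℕₚ.m≤m+n μ (k ℕ.* μ))) ⟩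
      - + μ                 ∎
      where open ℤₚ.≤-Reasoning

  -- The least y ≥ x with y ≡ c (mod μ); for μ = 0 it is c, even when c < x.
  up : ℤ → ℤ → ℕ → ℤ
  up x c zero      = c
  up x c μ@(suc _) = x + + ((c - x) %ℕ μ)

  up-congruent : ∀ x c μ → c ≡[mod μ ] up x c μ
  up-congruent x c zero      = ≡-mod-refl c
  up-congruent x c μ@(suc _) = ≡-mod (divides (- q) (begin
    (x + + r) - c          ≡⟨ rearrange x c (+ r) ⟩
    + r - (c - x)          ≡⟨ cong (_-_ (+ r)) (a≡a%ℕn+[a/ℕn]*n (c - x) μ) ⟩
    + r - (+ r + q * + μ)  ≡⟨ cancel (+ r) q (+ μ) ⟩
    - q * + μ              ∎))
    where
    open ≡-Reasoning
    r = (c - x) %ℕ μ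
    q = (c - x) /ℕ μ
    rearrange : ∀ a b d → (a + d) - b ≡ d - (b - a)
    rearrange = solve-∀
    cancel : ∀ a b d → a - (a + b * d) ≡ - b * d
    cancel = solve-∀

  up-ge : ∀ {x y c} μ → x ≤ y → c ≡[mod μ ] y → x ≤ up x c μ
  up-ge     zero      x≤y c≡y = ℤₚ.≤-trans x≤y (ℤₚ.≤-reflexive (sym (≡-mod-0⇒≡ c≡y)))
  up-ge {x} (suc _)   _   _   = ℤₚ.i≤i+j x (+ _)

  up-least : ∀ {x y c} μ → x ≤ y → c ≡[mod μ ] y → up x c μ ≤ y
  up-least         zero      _   c≡y = ℤₚ.≤-reflexive (≡-mod-0⇒≡ c≡y)
  up-least {x} {y} {c} μ@(suc _) x≤y c≡y =
    ℤₚ.0≤i-j⇒j≤i (nonneg-multiple (_≡[mod_]_.∣difference up≡y) -μ<y-up)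
    where
    up≡y : up x c μ ≡[mod μ ] y
    up≡y = ≡-mod-trans (≡-mod-sym (up-congruent x c μ)) c≡y
    r = (c - x) %ℕ μ
    -μ<y-up : - + μ < y - up x c μ
    -μ<y-up = begin-strict
      - + μ                 <⟨ ℤₚ.neg-mono-< (ℤ.+<+ (n%ℕd<d (c - x) μ)) ⟩
      - + r                 ≡⟨ ℤₚ.+-identityˡ (- + r) ⟨
      0ℤ - + r              ≤⟨ ℤₚ.+-monoˡ-≤ (- + r) (ℤₚ.i≤j⇒0≤j-i x≤y) ⟩
      (y - x) - + r         ≡⟨ rearrange y x (+ r) ⟩
      y - (x + + r)         ∎
      where
      open ℤₚ.≤-Reasoning
      rearrange : ∀ a b d → (a - b) - d ≡ a - (b + d)
      rearrange = solve-∀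

  Monotone : (ℕ → ℤ) → Set
  Monotone f = ∀ t → f t ≤ f (suc t)

  Monotone⇒≤ : ∀ {f} → Monotone f → ∀ {i j} → i ℕ.≤ j → f i ≤ f j
  Monotone⇒≤ {f} mono {i} {j} i≤j = subst (λ k → f i ≤ f k) (ℕₚ.m∸n+n≡m i≤j) (ascend (j ℕ.∸ i))
    where
    ascend : ∀ d → f i ≤ f (d ℕ.+ i)
    ascend zero    = ℤₚ.≤-refl
    ascend (suc d) = ℤₚ.≤-trans (ascend d) (mono (d ℕ.+ i))

  record Admissible (c : ℕ → ℤ) (ν : ℕ → ℕ) (R : ℕ → ℤ) : Set where
    field
      monotone  : Monotone R
      congruent : ∀ t → c t ≡[mod ν t ] R t

  greedy : (ℕ → ℤ) → (ℕ → ℕ) → ℕ → ℤ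
  greedy c ν zero    = c 0
  greedy c ν (suc t) = up (greedy c ν t) (c (suc t)) (ν (suc t))

  greedy-congruent : ∀ c ν t → c t ≡[mod ν t ] greedy c ν t
  greedy-congruent c ν zero    = ≡-mod-refl (c 0)
  greedy-congruent c ν (suc t) = up-congruent (greedy c ν t) (c (suc t)) (ν (suc t))

  module _ {c ν R} (ν0≡0 : ν 0 ≡ 0) (R-admissible : Admissible c ν R) where
    open Admissible R-admissible

    greedy-least : ∀ t → greedy c ν t ≤ R t
    greedy-least zero    = ℤₚ.≤-reflexive (≡-mod-0⇒≡ (subst (λ μ → c 0 ≡[mod μ ] R 0) ν0≡0 (congruent 0)))
    greedy-least (suc t) = up-least (ν (suc t)) (ℤₚ.≤-trans (greedy-least t) (monotone t)) (congruent (suc t))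

    greedy-admissible : Admissible c ν (greedy c ν)
    greedy-admissible = record
      { monotone  = λ t → up-ge (ν (suc t)) (ℤₚ.≤-trans (greedy-least t) (monotone t)) (congruent (suc t))
      ; congruent = greedy-congruent c ν
      }

  reflect : ℕ → (ℕ → ℤ) → ℕ → ℤ
  reflect N f t = - f (N ℕ.∸ t)

  reflect-involutive : ∀ {N u} f → u ℕ.≤ N → reflect N (reflect N f) u ≡ f u
  reflect-involutive {N} {u} f u≤N = trans (ℤₚ.neg-involutive _) (cong f (ℕₚ.m∸[m∸n]≡n u≤N))

  reflect-monotone : ∀ {N f} → Monotone f → Monotone (reflect N f)
  reflect-monotone {N} mono t = ℤₚ.neg-mono-≤ (Monotone⇒≤ mono (ℕₚ.∸-monoʳ-≤ N (ℕₚ.n≤1+n t)))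

  reflect-admissible : ∀ {N c ν R} → Admissible c ν R → Admissible (reflect N c) (ν ∘ (N ℕ.∸_)) (reflect N R)
  reflect-admissible {N} R-admissible = record
    { monotone  = reflect-monotone monotone
    ; congruent = λ t → ≡-mod-neg (congruent (N ℕ.∸ t))
    }
    where open Admissible R-admissible

  greatest : ℕ → (ℕ → ℤ) → (ℕ → ℕ) → ℕ → ℤ
  greatest N c ν = reflect N (greedy (reflect N c) (ν ∘ (N ℕ.∸_)))

  Settled : ℕ → (ℕ → ℤ) → (ℕ → ℕ) → Set
  Settled N c ν = ∀ u → N ℕ.≤ u → ν u ≡ 0 × c u ≡ c N

  module _ {N c ν} (settled : Settled N c ν) where
    private
      ν' = ν ∘ (N ℕ.∸_)
      ν'0≡0 : ν' 0 ≡ 0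
      ν'0≡0 = proj₁ (settled N ℕₚ.≤-refl)

      greatest-beyond : ∀ {u} → N ℕ.≤ u → greatest N c ν u ≡ c N
      greatest-beyond {u} N≤u rewrite ℕₚ.m≤n⇒m∸n≡0 N≤u = ℤₚ.neg-involutive (c (N ℕ.∸ 0))

    greatest-congruent : ∀ u → c u ≡[mod ν u ] greatest N c ν u
    greatest-congruent u with u ℕ.≤? N
    ... | yes u≤N = subst₂ (λ x μ → x ≡[mod μ ] greatest N c ν u)
                      (reflect-involutive c u≤N) (cong ν (ℕₚ.m∸[m∸n]≡n u≤N))
                      (≡-mod-neg (greedy-congruent (reflect N c) ν' (N ℕ.∸ u)))
    ... | no  u≰N = ≡-mod-reflexive (trans (proj₂ (settled u N≤u)) (sym (greatest-beyond N≤u)))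
      where N≤u = ℕₚ.<⇒≤ (ℕₚ.≰⇒> u≰N)

    module _ {R} (R-admissible : Admissible c ν R) where
      private
        R' = reflect-admissible {N} R-admissible

        R-beyond : ∀ {u} → N ℕ.≤ u → R u ≡ c N
        R-beyond {u} N≤u with settled u N≤u
        ... | ν≡0 , c≡cN =
          trans (sym (≡-mod-0⇒≡ (subst (λ μ → c u ≡[mod μ ] R u) ν≡0 (Admissible.congruent R-admissible u)))) c≡cN

      greatest-greatest : ∀ u → R u ≤ greatest N c ν u
      greatest-greatest u with u ℕ.≤? N
      ... | yes u≤N = subst (_≤ greatest N c ν u) (reflect-involutive R u≤N)
                        (ℤₚ.neg-mono-≤ (greedy-least ν'0≡0 R' (N ℕ.∸ u)))
      ... | no  u≰N = ℤₚ.≤-reflexive (trans (R-beyond N≤u) (sym (greatest-beyond N≤u)))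
        where N≤u = ℕₚ.<⇒≤ (ℕₚ.≰⇒> u≰N)

      greatest-admissible : Admissible c ν (greatest N c ν)
      greatest-admissible = record
        { monotone  = reflect-monotone (Admissible.monotone (greedy-admissible ν'0≡0 R'))
        ; congruent = greatest-congruent
        }

  splice : ℕ → (ℕ → ℤ) → (ℕ → ℤ) → ℕ → ℤ
  splice k G H u with u ℕ.≤? k
  ... | yes _ = G u
  ... | no  _ = H u

  splice-≤ : ∀ {k G H u} → u ℕ.≤ k → splice k G H u ≡ G u
  splice-≤ {k} {u = u} u≤k with u ℕ.≤? k
  ... | yes _   = refl
  ... | no  u≰k = ⊥-elim (u≰k u≤k)

  splice-> : ∀ {k G H u} → k ℕ.< u → splice k G H u ≡ H u
  splice-> {k} {u = u} k<u with u ℕ.≤? k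
  ... | yes u≤k = ⊥-elim (ℕₚ.<⇒≱ k<u u≤k)
  ... | no  _   = refl

  splice-admissible : ∀ {c ν G H} k → Admissible c ν G → Admissible c ν H → (∀ u → G u ≤ H u) →
                      Admissible c ν (splice k G H)
  splice-admissible {c} {ν} {G} {H} k G-admissible H-admissible G≤H = record
    { monotone = monotone ; congruent = congruent }
    where
    module G = Admissible G-admissible
    module H = Admissible H-admissible
    monotone : Monotone (splice k G H)
    monotone u with u ℕ.≤? k | suc u ℕ.≤? k
    ... | yes _   | yes _     = G.monotone u
    ... | yes _   | no  _     = ℤₚ.≤-trans (G≤H u) (H.monotone u)
    ... | no  u≰k | yes 1+u≤k = ⊥-elim (u≰k (ℕₚ.<⇒≤ 1+u≤k))
    ... | no  _   | no  _     = H.monotone u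
    congruent : ∀ u → c u ≡[mod ν u ] splice k G H u
    congruent u with u ℕ.≤? k
    ... | yes _ = G.congruent u
    ... | no  _ = H.congruent u

  i+1≤j⇒1≤j-i : ∀ {i j} → i + 1ℤ ≤ j → 1ℤ ≤ j - i
  i+1≤j⇒1≤j-i {i} {j} i+1≤j = subst (_≤ j - i) (cancel i 1ℤ) (ℤₚ.+-monoˡ-≤ (- i) i+1≤j)
    where
    cancel : ∀ x y → (x + y) - x ≡ y
    cancel = solve-∀

  lcmAll-least : ∀ s (a : Fin s → ℕ) {x} → (∀ j → a j ∣ℕ x) → lcmAll s a ∣ℕ x
  lcmAll-least zero    a {x} _   = 1∣ x
  lcmAll-least (suc s) a     a∣x = lcm-least (a∣x Fin.zero) (lcmAll-least s (a ∘ Fin.suc) (a∣x ∘ Fin.suc))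

  ∣∣⇒≤ : ∀ {L δ} → 1ℤ ≤ δ → L ∣ℕ ℤ.∣ δ ∣ → + L ≤ δ
  ∣∣⇒≤ (ℤ.+≤+ 1≤d) L∣d = ℤ.+≤+ (∣⇒≤ {{ℕ.>-nonZero 1≤d}} L∣d)

  ≡-mod⇒∣∣ : ∀ {μ x y} → x ≡[mod μ ] y → μ ∣ℕ ℤ.∣ y - x ∣
  ≡-mod⇒∣∣ (≡-mod μ∣y-x) = ∣⇒∣ᵤ μ∣y-x

  mod-aligned : ∀ {S} .{{_ : NonZero S}} (j : Fin S) q → (toℕ j ℕ.+ q ℕ.* S) mod S ≡ j
  mod-aligned {S} j q = Finₚ.toℕ-injective (begin
    toℕ ((toℕ j ℕ.+ q ℕ.* S) mod S) ≡⟨ Finₚ.toℕ-fromℕ< _ ⟩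
    (toℕ j ℕ.+ q ℕ.* S) % S         ≡⟨ [m+kn]%n≡m%n (toℕ j) q S ⟩
    toℕ j % S                       ≡⟨ m<n⇒m%n≡m (Finₚ.toℕ<n j) ⟩
    toℕ j                           ∎)
    where open ≡-Reasoning

  Monotone-pinned : ∀ {f} → Monotone f → ∀ {i t j} → i ℕ.≤ t → t ℕ.≤ j → f j ≡ f i → f t ≡ f i
  Monotone-pinned mono i≤t t≤j fj≡fi =
    ℤₚ.≤-antisym (ℤₚ.≤-trans (Monotone⇒≤ mono t≤j) (ℤₚ.≤-reflexive fj≡fi)) (Monotone⇒≤ mono i≤t)

  +-squeezeˡ : ∀ {a a' b b'} → a ≤ a' → b ≤ b' → a' + b' ≤ a + b → a' ≡ a
  +-squeezeˡ {a} {a'} {b} {b'} a≤a' b≤b' a'+b'≤a+b = ℤₚ.≤-antisym (begin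
    a'              ≡⟨ cancel a' b ⟩
    (a' + b) - b    ≤⟨ ℤₚ.+-monoˡ-≤ (- b) (ℤₚ.≤-trans (ℤₚ.+-monoʳ-≤ a' b≤b') a'+b'≤a+b) ⟩
    (a + b) - b     ≡⟨ cancel a b ⟨
    a               ∎) a≤a'
    where
    open ℤₚ.≤-Reasoning
    cancel : ∀ x y → x ≡ (x + y) - y
    cancel = solve-∀

  blocks-fit : ∀ {S ℓ} N → 1 ℕ.≤ S → S ℕ.* N ℕ.≤ ℓ ℕ.+ 1 → ℕ.pred N ℕ.* S ℕ.≤ ℓ
  blocks-fit {S} {ℓ} zero    _   _           = z≤n
  blocks-fit {S} {ℓ} (suc q) 1≤S SN≤ℓ+1 = subst (ℕ._≤ ℓ) (ℕₚ.*-comm S q) (ℕₚ.+-cancelˡ-≤ 1 (S ℕ.* q) ℓ (begin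
    1 ℕ.+ S ℕ.* q   ≤⟨ ℕₚ.+-monoˡ-≤ (S ℕ.* q) 1≤S ⟩
    S ℕ.+ S ℕ.* q   ≡⟨ ℕₚ.*-suc S q ⟨
    S ℕ.* suc q     ≤⟨ SN≤ℓ+1 ⟩
    ℓ ℕ.+ 1         ≡⟨ ℕₚ.+-comm ℓ 1 ⟩
    1 ℕ.+ ℓ         ∎))
    where open ℕₚ.≤-Reasoning

  too-many-blocks : ∀ {g L} → 1ℤ ≤ g → g < + L → + ℕ.pred (L ℕ.* L) ≤ g + g → ⊥
  too-many-blocks {+ G} {L} (ℤ.+≤+ 1≤G) (ℤ.+<+ G<L) (ℤ.+≤+ blocks≤2G) = ℕₚ.<⇒≱ (begin-strict
    G ℕ.+ G                    <⟨ ℕₚ.+-monoʳ-< G (ℕₚ.m≤n*m (suc G) G {{ℕ.>-nonZero 1≤G}}) ⟩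
    G ℕ.+ G ℕ.* suc G          ≡⟨⟩
    ℕ.pred (suc G ℕ.* suc G)   ≤⟨ ℕₚ.pred-mono-≤ (ℕₚ.*-mono-≤ G<L G<L) ⟩
    ℕ.pred (L ℕ.* L)           ∎) blocks≤2G
    where open ℕₚ.≤-Reasoning

  module _ {S : ℕ} .{{_ : NonZero S}} (a : Fin S → ℕ) (ℓ : ℕ) {x y : ℕ → ℤ}
           (x-monotone : Monotone x) (y-monotone : Monotone y) (x≤y : ∀ t → x t ≤ y t)
           (jump : ∀ t → t ℕ.≤ ℓ → x t + 1ℤ ≤ y (suc t))
           (periodic : ∀ t → t ℕ.< ℓ → x (suc t) ≡[mod a (t mod S) ] y (suc t))
    where

    private
      L : ℕ
      L = lcmAll S a

      1≤S : 1 ℕ.≤ S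
      1≤S = ℕ.>-nonZero⁻¹ S

      stalled-gap : ∀ q → suc q ℕ.* S ℕ.≤ ℓ →
                    x (suc q ℕ.* S) ≡ x (q ℕ.* S) → y (suc q ℕ.* S) ≡ y (q ℕ.* S) →
                    + L ≤ y (q ℕ.* S) - x (q ℕ.* S)
      stalled-gap q end≤ℓ x-stalls y-stalls = ∣∣⇒≤ 1≤δ (lcmAll-least S a a∣δ)
        where
        r = q ℕ.* S
        x-flat : ∀ t → r ℕ.≤ t → t ℕ.≤ S ℕ.+ r → x t ≡ x r
        x-flat t r≤t t≤end = Monotone-pinned x-monotone r≤t t≤end x-stalls
        y-flat : ∀ t → r ℕ.≤ t → t ℕ.≤ S ℕ.+ r → y t ≡ y r
        y-flat t r≤t t≤end = Monotone-pinned y-monotone r≤t t≤end y-stalls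
        1+r≤end : suc r ℕ.≤ S ℕ.+ r
        1+r≤end = ℕₚ.+-monoˡ-≤ r 1≤S
        1≤δ : 1ℤ ≤ y r - x r
        1≤δ = i+1≤j⇒1≤j-i (subst (x r + 1ℤ ≤_) (y-flat (suc r) (ℕₚ.n≤1+n r) 1+r≤end)
                (jump r (ℕₚ.≤-trans (ℕₚ.≤-trans (ℕₚ.n≤1+n r) 1+r≤end) end≤ℓ)))
        a∣δ : ∀ j → a j ∣ℕ ℤ.∣ y r - x r ∣
        a∣δ j = ≡-mod⇒∣∣ (subst₂ (λ u v → u ≡[mod a j ] v)
                  (x-flat (suc t) r≤1+t 1+t≤end) (y-flat (suc t) r≤1+t 1+t≤end)
                  (subst (λ i → x (suc t) ≡[mod a i ] y (suc t)) (mod-aligned j q) (periodic t t<ℓ)))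
          where
          t = toℕ j ℕ.+ r
          1+t≤end : suc t ℕ.≤ S ℕ.+ r
          1+t≤end = ℕₚ.+-monoˡ-≤ r (Finₚ.toℕ<n j)
          r≤1+t : r ℕ.≤ suc t
          r≤1+t = ℕₚ.m≤n⇒m≤1+n (ℕₚ.m≤n+m r (toℕ j))
          t<ℓ : t ℕ.< ℓ
          t<ℓ = ℕₚ.<-≤-trans 1+t≤end end≤ℓ

      module _ (gap<L : y (suc ℓ) - x 0 < + L) where

        block-progress : ∀ q → suc q ℕ.* S ℕ.≤ ℓ →
                         x (q ℕ.* S) + y (q ℕ.* S) < x (suc q ℕ.* S) + y (suc q ℕ.* S)
        block-progress q end≤ℓ with (x (q ℕ.* S) + y (q ℕ.* S)) ℤₚ.<? (x (suc q ℕ.* S) + y (suc q ℕ.* S))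
        ... | yes progress = progress
        ... | no  no-progress = ⊥-elim (ℤₚ.<⇒≱ gap<L (ℤₚ.≤-trans (stalled-gap q end≤ℓ x-stalls y-stalls) within))
          where
          r = q ℕ.* S
          end = suc q ℕ.* S
          r≤end : r ℕ.≤ end
          r≤end = ℕₚ.m≤n+m r S
          sum-stalls : x end + y end ≤ x r + y r
          sum-stalls = ℤₚ.≮⇒≥ no-progress
          x-stalls : x end ≡ x r
          x-stalls = +-squeezeˡ (Monotone⇒≤ x-monotone r≤end) (Monotone⇒≤ y-monotone r≤end) sum-stalls
          y-stalls : y end ≡ y r
          y-stalls = +-squeezeˡ (Monotone⇒≤ y-monotone r≤end) (Monotone⇒≤ x-monotone r≤end)
                       (subst₂ _≤_ (ℤₚ.+-comm (x end) (y end)) (ℤₚ.+-comm (x r) (y r)) sum-stalls)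
          within : y r - x r ≤ y (suc ℓ) - x 0
          within = ℤₚ.+-mono-≤ (Monotone⇒≤ y-monotone (ℕₚ.m≤n⇒m≤1+n (ℕₚ.≤-trans r≤end end≤ℓ)))
                                (ℤₚ.neg-mono-≤ (Monotone⇒≤ x-monotone z≤n))

        progress : ∀ q → q ℕ.* S ℕ.≤ ℓ → x 0 + y 0 + + q ≤ x (q ℕ.* S) + y (q ℕ.* S)
        progress zero    _     = ℤₚ.≤-reflexive (ℤₚ.+-identityʳ (x 0 + y 0))
        progress (suc q) end≤ℓ = begin
          x 0 + y 0 + + suc q         ≡⟨ shuffle (x 0 + y 0) (+ q) ⟩
          1ℤ + (x 0 + y 0 + + q)      ≤⟨ ℤₚ.+-monoʳ-≤ 1ℤ (progress q (ℕₚ.≤-trans (ℕₚ.m≤n+m r S) end≤ℓ)) ⟩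
          1ℤ + (x r + y r)            ≤⟨ ℤₚ.i<j⇒suc[i]≤j (block-progress q end≤ℓ) ⟩
          x (suc q ℕ.* S) + y (suc q ℕ.* S) ∎
          where
          open ℤₚ.≤-Reasoning
          r = q ℕ.* S
          shuffle : ∀ u v → u + (1ℤ + v) ≡ 1ℤ + (u + v)
          shuffle = solve-∀

    gap-bound : S ℕ.* lcmAll S a ℕ.^ 2 ℕ.≤ ℓ ℕ.+ 1 → + lcmAll S a ≤ y (suc ℓ) - x 0
    gap-bound SL²≤ℓ+1 with + L ℤₚ.≤? y (suc ℓ) - x 0
    ... | yes L≤gap = L≤gap
    ... | no  L≰gap = ⊥-elim (too-many-blocks 1≤gap gap<L counted)
      where
      gap = y (suc ℓ) - x 0
      gap<L : gap < + L
      gap<L = ℤₚ.≰⇒> L≰gap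
      1≤gap : 1ℤ ≤ gap
      1≤gap = i+1≤j⇒1≤j-i (ℤₚ.≤-trans (jump 0 z≤n) (Monotone⇒≤ y-monotone (s≤s z≤n)))
      q = ℕ.pred (L ℕ.* L)
      qS≤ℓ : q ℕ.* S ℕ.≤ ℓ
      qS≤ℓ = blocks-fit (L ℕ.* L) 1≤S
               (subst (λ N → S ℕ.* N ℕ.≤ ℓ ℕ.+ 1) (cong (L ℕ.*_) (ℕₚ.*-identityʳ L)) SL²≤ℓ+1)
      r = q ℕ.* S
      y-r≤y-end : y r ≤ y (suc ℓ)
      y-r≤y-end = Monotone⇒≤ y-monotone (ℕₚ.m≤n⇒m≤1+n qS≤ℓ)
      counted : + q ≤ gap + gap
      counted = begin
        + q                                     ≡⟨ cancel (x 0 + x 0) (+ q) ⟩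
        (x 0 + x 0 + + q) - (x 0 + x 0)         ≤⟨ ℤₚ.+-monoˡ-≤ (- (x 0 + x 0))
                                                     (ℤₚ.≤-trans (ℤₚ.+-monoˡ-≤ (+ q) (ℤₚ.+-monoʳ-≤ (x 0) (x≤y 0)))
                                                                 (progress gap<L q qS≤ℓ)) ⟩
        (x r + y r) - (x 0 + x 0)               ≤⟨ ℤₚ.+-monoˡ-≤ (- (x 0 + x 0))
                                                     (ℤₚ.+-mono-≤ (ℤₚ.≤-trans (x≤y r) y-r≤y-end) y-r≤y-end) ⟩
        (y (suc ℓ) + y (suc ℓ)) - (x 0 + x 0)   ≡⟨ regroup (y (suc ℓ)) (x 0) ⟩
        gap + gap                               ∎
        where
        open ℤₚ.≤-Reasoning
        cancel : ∀ u v → v ≡ (u + v) - u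
        cancel = solve-∀
        regroup : ∀ u v → (u + u) - (v + v) ≡ (u - v) + (u - v)
        regroup = solve-∀

module BananaPaths where

  open IntegerSequences
  open import Defs
  open import Data.Nat as ℕ using (ℕ; zero; suc; z≤n; s≤s; NonZero)
  import Data.Nat.Properties as ℕₚ
  open import Data.Nat.DivMod using (_mod_)
  open import Data.Integer as ℤ using (ℤ; +_; -[1+_]; 0ℤ; 1ℤ; _+_; _-_; -_; _*_; _≤_)
  import Data.Integer.Properties as ℤₚ
  open import Data.Integer.Divisibility.Signed using (_∣_; divides; ∣-refl; ∣m∣n⇒∣m-n; quotient)
  open import Data.Integer.Tactic.RingSolver using (solve-∀)
  open import Data.Fin as Fin using (Fin; toℕ; fromℕ<)
  import Data.Fin.Properties as Finₚ
  open import Data.List using ([]; _∷_; map; tabulate; allFin)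
  open import Data.Product using (Σ; _×_; _,_; proj₁; proj₂)
  open import Data.Sum using (inj₁; inj₂)
  open import Data.Empty using (⊥-elim)
  open import Function using (_∘_)
  open import Relation.Nullary using (yes; no)
  open import Relation.Binary.PropositionalEquality
  open import Relation.Binary.Construct.Closure.ReflexiveTransitive using (ε; _◅_; _◅◅_; fold)

  module _ {n : ℕ} where

    pad : Divisor n → ℕ → ℤ
    pad D i with i ℕ.<? suc n
    ... | yes i<N = D (fromℕ< i<N)
    ... | no  _   = 0ℤ

    pad-toℕ : ∀ D w → pad D (toℕ w) ≡ D w
    pad-toℕ D w with toℕ w ℕ.<? suc n
    ... | yes w<N = cong D (Finₚ.fromℕ<-toℕ w w<N)
    ... | no  w≮N = ⊥-elim (w≮N (Finₚ.toℕ<n w))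

    pad-beyond : ∀ D {i} → suc n ℕ.≤ i → pad D i ≡ 0ℤ
    pad-beyond D {i} N≤i with i ℕ.<? suc n
    ... | yes i<N = ⊥-elim (ℕₚ.<⇒≱ i<N N≤i)
    ... | no  _   = refl

    pad-unique : ∀ {D} g → (∀ w → D w ≡ g (toℕ w)) → (∀ i → suc n ℕ.≤ i → g i ≡ 0ℤ) →
                 ∀ i → pad D i ≡ g i
    pad-unique g on-vertices beyond i with i ℕ.<? suc n
    ... | yes i<N = trans (on-vertices (fromℕ< i<N)) (cong g (Finₚ.toℕ-fromℕ< i<N))
    ... | no  i≮N = sym (beyond i (ℕₚ.≮⇒≥ i≮N))

    pad-nonneg : ∀ {D} → Effective D → ∀ i → 0ℤ ≤ pad D i
    pad-nonneg D-effective i with i ℕ.<? suc n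
    ... | yes i<N = D-effective (fromℕ< i<N)
    ... | no  _   = ℤₚ.≤-refl

    prefix : Divisor n → ℕ → ℤ
    prefix D = prefixSum (pad D)

    prefix-perturb : ∀ {D D'} δ → (∀ w → D' w ≡ D w + δ (toℕ w)) → (∀ i → suc n ℕ.≤ i → δ i ≡ 0ℤ) →
                     ∀ u → prefix D' u ≡ prefix D u + prefixSum δ u
    prefix-perturb {D} δ on-vertices beyond u =
      trans (prefixSum-cong u (λ i _ → pad-unique (λ i → pad D i + δ i) on-vertices′ beyond′ i)) (prefixSum-+ (pad D) δ u)
      where
      on-vertices′ : ∀ w → _ ≡ pad D (toℕ w) + δ (toℕ w)
      on-vertices′ w = trans (on-vertices w) (cong (_+ δ (toℕ w)) (sym (pad-toℕ D w)))
      beyond′ : ∀ i → suc n ℕ.≤ i → pad D i + δ i ≡ 0ℤ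
      beyond′ i N≤i = cong₂ _+_ (pad-beyond D N≤i) (beyond i N≤i)

    prefix-cong : ∀ {D D'} → (∀ w → D w ≡ D' w) → ∀ u → prefix D u ≡ prefix D' u
    prefix-cong {D} {D'} D≗D' u = prefixSum-cong u (λ i _ → pad-unique (pad D') on-vertices (λ i → pad-beyond D') i)
      where
      on-vertices : ∀ w → D w ≡ pad D' (toℕ w)
      on-vertices w = trans (D≗D' w) (sym (pad-toℕ D' w))

    prefix-sub : ∀ D F u → prefix (λ v → D v - F v) u ≡ prefix D u - prefix F u
    prefix-sub D F u =
      trans (prefixSum-cong u (λ i _ → pad-unique (λ i → pad D i - pad F i) on-vertices beyond i)) (prefixSum-minus (pad D) (pad F) u)
      where
      on-vertices : ∀ w → D w - F w ≡ pad D (toℕ w) - pad F (toℕ w)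
      on-vertices w = sym (cong₂ _-_ (pad-toℕ D w) (pad-toℕ F w))
      beyond : ∀ i → suc n ℕ.≤ i → pad D i - pad F i ≡ 0ℤ
      beyond i N≤i = cong₂ _-_ (pad-beyond D N≤i) (pad-beyond F N≤i)

    prefix-stable : ∀ D {u} → suc n ℕ.≤ u → prefix D u ≡ prefix D (suc n)
    prefix-stable D {u} N≤u = subst (λ v → prefix D v ≡ prefix D (suc n)) (ℕₚ.m∸n+n≡m N≤u) (stable (u ℕ.∸ suc n))
      where
      stable : ∀ d → prefix D (d ℕ.+ suc n) ≡ prefix D (suc n)
      stable zero    = refl
      stable (suc d) = trans (cong₂ _+_ (stable d) (pad-beyond D (ℕₚ.m≤n+m (suc n) d))) (ℤₚ.+-identityʳ _)

    deg-prefix : ∀ D → deg D ≡ prefix D (suc n)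
    deg-prefix D = sumℤ-allFin (λ w → sym (pad-toℕ D w))

    effective⇒prefix-monotone : ∀ {D} → Effective D → Monotone (prefix D)
    effective⇒prefix-monotone {D} D-effective u =
      subst (_≤ prefix D (suc u)) (ℤₚ.+-identityʳ (prefix D u)) (ℤₚ.+-monoʳ-≤ (prefix D u) (pad-nonneg D-effective u))

    prefix-monotone⇒effective : ∀ {D} → Monotone (prefix D) → Effective D
    prefix-monotone⇒effective {D} mono w =
      subst (0ℤ ≤_) (trans (cancel (prefix D i) (pad D i)) (pad-toℕ D w)) (ℤₚ.i≤j⇒0≤j-i (mono i))
      where
      i = toℕ w
      cancel : ∀ a b → (a + b) - a ≡ b
      cancel = solve-∀

  window : ℕ → ℕ → ℕ → ℤ → ℤ
  window k ℓ i x with k ℕ.≤? i | i ℕ.≤? k ℕ.+ ℓ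
  ... | yes _ | yes _ = x
  ... | _     | _     = 0ℤ

  window-steps : ∀ k ℓ i x → window k ℓ i x ≡ step i x (suc (k ℕ.+ ℓ)) - step i x k
  window-steps k ℓ i x with k ℕ.≤? i | i ℕ.≤? k ℕ.+ ℓ
  ... | yes k≤i | yes i≤k+ℓ = sym (trans (cong₂ _-_ (step-< x (s≤s i≤k+ℓ)) (step-≥ x k≤i)) (ℤₚ.+-identityʳ x))
  ... | yes k≤i | no  i≰k+ℓ = sym (cong₂ _-_ (step-≥ x (ℕₚ.≰⇒> i≰k+ℓ)) (step-≥ x k≤i))
  ... | no  k≰i | _         = sym (trans (cong₂ _-_ (step-< x i<1+k+ℓ) (step-< x i<k)) (ℤₚ.+-inverseʳ x))
    where
    i<k = ℕₚ.≰⇒> k≰i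
    i<1+k+ℓ = ℕₚ.<-≤-trans i<k (ℕₚ.m≤n⇒m≤1+n (ℕₚ.m≤m+n k ℓ))

  private
    firstChip : ∀ {n} → Divisor n → ℕ → ℤ
    firstChip D zero    = D Fin.zero
    firstChip D (suc _) = 0ℤ

    -- The summand of chipsOn is a local with-function that can only be named by unification,
    -- which succeeds once splitting on k has made the first summand reduce.
    chipsOn-summand : ∀ {n} (D : Divisor n) k ℓ →
                      Σ (Fin (suc n) → ℤ) λ f → chipsOn D k ℓ ≡ firstChip D k + sumℤ (map f (tabulate Fin.suc))
    chipsOn-summand D zero    ℓ = _ , refl
    chipsOn-summand D (suc k) ℓ = _ , refl

    summand-window : ∀ {n} (D : Divisor n) k ℓ v → proj₁ (chipsOn-summand D k ℓ) v ≡ window k ℓ (toℕ v) (D v)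
    summand-window D zero ℓ v with 0 ℕ.≤? toℕ v | toℕ v ℕ.≤? 0 ℕ.+ ℓ
    ... | yes _ | yes _ = refl
    ... | yes _ | no  _ = refl
    ... | no  _ | _     = refl
    summand-window D (suc k) ℓ v with suc k ℕ.≤? toℕ v | toℕ v ℕ.≤? suc k ℕ.+ ℓ
    ... | yes _ | yes _ = refl
    ... | yes _ | no  _ = refl
    ... | no  _ | _     = refl

    sumℤ-map-cong : ∀ {A : Set} {f g : A → ℤ} → (∀ x → f x ≡ g x) → ∀ xs → sumℤ (map f xs) ≡ sumℤ (map g xs)
    sumℤ-map-cong f≗g []       = refl
    sumℤ-map-cong f≗g (x ∷ xs) = cong₂ _+_ (f≗g x) (sumℤ-map-cong f≗g xs)

  chipsOn-window : ∀ {n} (D : Divisor n) k ℓ →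
                   chipsOn D k ℓ ≡ sumℤ (map (λ v → window k ℓ (toℕ v) (D v)) (allFin (suc n)))
  chipsOn-window D k ℓ = trans (proj₂ (chipsOn-summand D k ℓ))
    (cong₂ _+_ (first-window k) (sumℤ-map-cong (summand-window D k ℓ) (tabulate Fin.suc)))
    where
    first-window : ∀ j → firstChip D j ≡ window j ℓ 0 (D Fin.zero)
    first-window zero    = refl
    first-window (suc j) = refl

  chipsOn-prefix : ∀ {n} (D : Divisor n) {k ℓ} → k ℕ.+ ℓ ℕ.≤ n →
                   chipsOn D k ℓ ≡ prefix D (suc (k ℕ.+ ℓ)) - prefix D k
  chipsOn-prefix {n} D {k} {ℓ} k+ℓ≤n = begin
    chipsOn D k ℓ
      ≡⟨ chipsOn-window D k ℓ ⟩
    sumℤ (map (λ v → window k ℓ (toℕ v) (D v)) (allFin (suc n)))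
      ≡⟨ sumℤ-allFin (λ w → cong (window k ℓ (toℕ w)) (sym (pad-toℕ D w))) ⟩
    prefixSum (λ i → window k ℓ i (pad D i)) (suc n)
      ≡⟨ prefixSum-cong (suc n) (λ i _ → window-steps k ℓ i (pad D i)) ⟩
    prefixSum (λ i → step i (pad D i) (suc (k ℕ.+ ℓ)) - step i (pad D i) k) (suc n)
      ≡⟨ prefixSum-minus _ _ (suc n) ⟩
    prefixSum (λ i → step i (pad D i) (suc (k ℕ.+ ℓ))) (suc n) - prefixSum (λ i → step i (pad D i) k) (suc n)
      ≡⟨ cong₂ _-_ (prefixSum-below (pad D) (suc n) (s≤s k+ℓ≤n)) (prefixSum-below (pad D) (suc n) k≤1+n) ⟩
    prefix D (suc (k ℕ.+ ℓ)) - prefix D k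
      ∎
    where
    open ≡-Reasoning
    k≤1+n : k ℕ.≤ suc n
    k≤1+n = ℕₚ.m≤n⇒m≤1+n (ℕₚ.≤-trans (ℕₚ.m≤m+n k ℓ) k+ℓ≤n)

  module BananaPath {n : ℕ} (m : Fin n → ℕ) where

    -- crossing u = |E(v_{u-1}, v_u)|, which vanishes for u = 0 and u > n.
    crossing : ℕ → ℕ
    crossing zero    = 0
    crossing (suc i) = extMult m i

    crossing-beyond : ∀ {u} → suc n ℕ.≤ u → crossing u ≡ 0
    crossing-beyond {suc i} (s≤s n≤i) with i ℕ.<? n
    ... | yes i<n = ⊥-elim (ℕₚ.<⇒≱ i<n n≤i)
    ... | no  _   = refl

    crossing-fromℕ< : ∀ {i} (i<n : i ℕ.< n) → crossing (suc i) ≡ m (fromℕ< i<n)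
    crossing-fromℕ< {i} i<n with i ℕ.<? n
    ... | yes _   = refl
    ... | no  i≮n = ⊥-elim (i≮n i<n)

    cut : ℕ → ℕ → ℤ
    cut a = spike a (+ crossing a)

    cut-self : ∀ {a i} → i ≡ a → cut a i ≡ + crossing i
    cut-self {a} refl = spike-self a (+ crossing a)

    cut-other : ∀ {a i} → i ≢ a → cut a i ≡ 0ℤ
    cut-other {a} = spike-other (+ crossing a)

    cut-beyond : ∀ a {i} → suc n ℕ.≤ i → cut a i ≡ 0ℤ
    cut-beyond a {i} N≤i with i ℕ.≟ a
    ... | yes refl = cong +_ (crossing-beyond N≤i)
    ... | no  _    = refl

    cut-zeroʳ : ∀ a → cut a 0 ≡ 0ℤ
    cut-zeroʳ a with 0 ℕ.≟ a
    ... | yes refl = refl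
    ... | no  _    = refl

    cut-zeroˡ : ∀ u → cut 0 u ≡ 0ℤ
    cut-zeroˡ u with u ℕ.≟ 0
    ... | yes _ = refl
    ... | no  _ = refl

    crossing∣cut : ∀ a u → + crossing u ∣ cut a u
    crossing∣cut a u with u ℕ.≟ a
    ... | yes refl = ∣-refl
    ... | no  _    = divides 0ℤ refl

    prefixSum-cut : ∀ a {N} → suc n ℕ.≤ N → prefixSum (cut a) N ≡ + crossing a
    prefixSum-cut a {N} n<N = trans (prefixSum-spike a (+ crossing a) N)
      (step-saturated (+ crossing a) (λ N≤a → cong +_ (crossing-beyond (ℕₚ.≤-trans n<N N≤a))))

    E-cut : ∀ v w → + E m v w ≡ cut (suc (toℕ v)) (toℕ w) + cut (toℕ v) (suc (toℕ w))
    E-cut v w with toℕ w ℕ.≟ suc (toℕ v)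
    ... | yes i≡1+a = sym (trans (cong (_+_ (+ crossing (suc (toℕ v)))) (cut-other 1+i≢a)) (ℤₚ.+-identityʳ _))
      where
      1+i≢a : suc (toℕ w) ≢ toℕ v
      1+i≢a 1+i≡a = ℕₚ.<-irrefl (trans (sym 1+i≡a) (cong suc i≡1+a)) (ℕₚ.m<n⇒m<1+n (ℕₚ.n<1+n (toℕ v)))
    ... | no  _ with toℕ v ℕ.≟ suc (toℕ w)
    ...   | yes a≡1+i = sym (trans (ℤₚ.+-identityˡ _) (cut-self (sym a≡1+i)))
    ...   | no  a≢1+i = sym (trans (ℤₚ.+-identityˡ _) (cut-other (a≢1+i ∘ sym)))

    val-crossing : ∀ v → + val m v ≡ + crossing (suc (toℕ v)) + + crossing (toℕ v)
    val-crossing v = begin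
      + val m v                                                     ≡⟨ pos-sumℕ (E m v) (allFin (suc n)) ⟩
      sumℤ (map (+_ ∘ E m v) (allFin (suc n)))                      ≡⟨ sumℤ-allFin (E-cut v) ⟩
      prefixSum (λ i → cut (suc a) i + cut a (suc i)) (suc n)       ≡⟨ prefixSum-+ (cut (suc a)) (cut a ∘ suc) (suc n) ⟩
      prefixSum (cut (suc a)) (suc n) + prefixSum (cut a ∘ suc) (suc n)
                                                                    ≡⟨ cong₂ _+_ (prefixSum-cut (suc a) ℕₚ.≤-refl) shifted ⟩
      + crossing (suc a) + + crossing a                             ∎
      where
      open ≡-Reasoning
      a = toℕ v
      shifted : prefixSum (cut a ∘ suc) (suc n) ≡ + crossing a
      shifted = begin
        prefixSum (cut a ∘ suc) (suc n)               ≡⟨ ℤₚ.+-identityˡ _ ⟨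
        0ℤ + prefixSum (cut a ∘ suc) (suc n)          ≡⟨ cong (_+ prefixSum (cut a ∘ suc) (suc n)) (cut-zeroʳ a) ⟨
        cut a 0 + prefixSum (cut a ∘ suc) (suc n)     ≡⟨ prefixSum-front (cut a) (suc n) ⟨
        prefixSum (cut a) (suc (suc n))               ≡⟨ prefixSum-cut a (ℕₚ.n≤1+n (suc n)) ⟩
        + crossing a                                  ∎

    fireShift : ℕ → ℕ → ℤ
    fireShift a u = cut a u - cut (suc a) u

    crossing∣fireShift : ∀ a u → + crossing u ∣ fireShift a u
    crossing∣fireShift a u = ∣m∣n⇒∣m-n (crossing∣cut a u) (crossing∣cut (suc a) u)

    fire-pointwise : ∀ D v w → fire m D v w ≡ D w + (fireShift (toℕ v) (suc (toℕ w)) - fireShift (toℕ v) (toℕ w))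
    fire-pointwise D v w with v Fin.≟ w
    ... | yes refl = begin
      D v - + val m v                                          ≡⟨ cong (_-_ (D v)) (val-crossing v) ⟩
      D v - (+ crossing (suc a) + + crossing a)                ≡⟨ rearrange (D v) (+ crossing (suc a)) (+ crossing a) ⟩
      D v + ((0ℤ - + crossing (suc a)) - (+ crossing a - 0ℤ))  ≡⟨ cong (λ z → D v + z) (cong₂ _-_
                                                                     (cong₂ _-_ (cut-other {a} ℕₚ.1+n≢n) (cut-self {suc a} refl))
                                                                     (cong₂ _-_ (cut-self {a} refl) (cut-other {suc a} (ℕₚ.1+n≢n ∘ sym)))) ⟨
      D v + (fireShift a (suc a) - fireShift a a)              ∎
      where
      open ≡-Reasoning
      a = toℕ v
      rearrange : ∀ d x y → d - (x + y) ≡ d + ((0ℤ - x) - (y - 0ℤ))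
      rearrange = solve-∀
    ... | no  v≢w = begin
      D w + + E m v w                                      ≡⟨ cong (_+_ (D w)) (E-cut v w) ⟩
      D w + (cut (suc a) i + cut a (suc i))                ≡⟨ rearrange (D w) (cut (suc a) i) (cut a (suc i)) ⟩
      D w + ((cut a (suc i) - 0ℤ) - (0ℤ - cut (suc a) i))  ≡⟨ cong (λ z → D w + z) (cong₂ _-_
                                                                 (cong (_-_ (cut a (suc i))) (cut-other (i≢a ∘ ℕₚ.suc-injective)))
                                                                 (cong (_- cut (suc a) i) (cut-other i≢a))) ⟨
      D w + (fireShift a (suc i) - fireShift a i)          ∎
      where
      open ≡-Reasoning
      a = toℕ v
      i = toℕ w
      i≢a : i ≢ a
      i≢a i≡a = v≢w (Finₚ.toℕ-injective (sym i≡a))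
      rearrange : ∀ d x y → d + (x + y) ≡ d + ((y - 0ℤ) - (0ℤ - x))
      rearrange = solve-∀

    prefix-fire : ∀ D v u → prefix (fire m D v) u ≡ prefix D u + fireShift (toℕ v) u
    prefix-fire D v u = begin
      prefix (fire m D v) u
        ≡⟨ prefix-perturb _ (fire-pointwise D v) beyond u ⟩
      prefix D u + prefixSum (λ i → fireShift a (suc i) - fireShift a i) u
        ≡⟨ cong (_+_ (prefix D u)) (prefixSum-telescope (fireShift a) u) ⟩
      prefix D u + (fireShift a u - fireShift a 0)
        ≡⟨ cong (λ z → prefix D u + (fireShift a u - z)) (cong₂ _-_ (cut-zeroʳ a) (cut-zeroʳ (suc a))) ⟩
      prefix D u + (fireShift a u - 0ℤ)
        ≡⟨ cong (_+_ (prefix D u)) (ℤₚ.+-identityʳ (fireShift a u)) ⟩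
      prefix D u + fireShift a u
        ∎
      where
      open ≡-Reasoning
      a = toℕ v
      beyond : ∀ i → suc n ℕ.≤ i → fireShift a (suc i) - fireShift a i ≡ 0ℤ
      beyond i N≤i = cong₂ _-_ (cong₂ _-_ (cut-beyond a N≤1+i) (cut-beyond (suc a) N≤1+i))
                               (cong₂ _-_ (cut-beyond a N≤i) (cut-beyond (suc a) N≤i))
        where N≤1+i = ℕₚ.m≤n⇒m≤1+n N≤i

    unfire : Divisor n → Fin (suc n) → Divisor n
    unfire D v w with v Fin.≟ w
    ... | yes _ = D w + + val m v
    ... | no  _ = D w - + E m v w

    unfire-self : ∀ D v → unfire D v v ≡ D v + + val m v
    unfire-self D v with v Fin.≟ v
    ... | yes _   = refl
    ... | no  v≢v = ⊥-elim (v≢v refl)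

    unfire-other : ∀ D {v w} → v ≢ w → unfire D v w ≡ D w - + E m v w
    unfire-other D {v} {w} v≢w with v Fin.≟ w
    ... | yes v≡w = ⊥-elim (v≢w v≡w)
    ... | no  _   = refl

    fire-unfire : ∀ D v w → fire m (unfire D v) v w ≡ D w
    fire-unfire D v w with v Fin.≟ w
    ... | yes refl = trans (cong (_- + val m v) (unfire-self D v)) (cancel (D v) (+ val m v))
      where
      cancel : ∀ x y → (x + y) - y ≡ x
      cancel = solve-∀
    ... | no  v≢w  = trans (cong (_+ + E m v w) (unfire-other D v≢w)) (cancel (D w) (+ E m v w))
      where
      cancel : ∀ x y → (x - y) + y ≡ x
      cancel = solve-∀

    prefix-unfire : ∀ D v u → prefix (unfire D v) u ≡ prefix D u - fireShift (toℕ v) u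
    prefix-unfire D v u = begin
      prefix (unfire D v) u                                   ≡⟨ cancel (prefix (unfire D v) u) (fireShift (toℕ v) u) ⟩
      (prefix (unfire D v) u + fireShift (toℕ v) u) - fireShift (toℕ v) u
                                                              ≡⟨ cong (_- fireShift (toℕ v) u) (prefix-fire (unfire D v) v u) ⟨
      prefix (fire m (unfire D v) v) u - fireShift (toℕ v) u  ≡⟨ cong (_- fireShift (toℕ v) u)
                                                                     (prefix-cong (fire-unfire D v) u) ⟩
      prefix D u - fireShift (toℕ v) u                        ∎
      where
      open ≡-Reasoning
      cancel : ∀ x y → x ≡ (x + y) - y
      cancel = solve-∀

    Shift : (ℕ → ℤ) → Set
    Shift f = ∀ D → Σ (Divisor n) λ D' → Equiv m D D' × (∀ u → prefix D' u ≡ prefix D u + f u)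

    shift-zero : Shift (λ _ → 0ℤ)
    shift-zero D = D , ε , λ u → sym (ℤₚ.+-identityʳ (prefix D u))

    shift-cong : ∀ {f g} → (∀ u → f u ≡ g u) → Shift f → Shift g
    shift-cong f≗g shift-f D =
      let D' , D~D' , prefix-D' = shift-f D
      in  D' , D~D' , λ u → trans (prefix-D' u) (cong (_+_ (prefix D u)) (f≗g u))

    shift-+ : ∀ {f g} → Shift f → Shift g → Shift (λ u → f u + g u)
    shift-+ {f} {g} shift-f shift-g D =
      let D₁ , D~D₁ , prefix-D₁ = shift-f D
          D₂ , D₁~D₂ , prefix-D₂ = shift-g D₁
      in  D₂ , D~D₁ ◅◅ D₁~D₂ ,
          λ u → trans (prefix-D₂ u) (trans (cong (_+ g u) (prefix-D₁ u)) (ℤₚ.+-assoc (prefix D u) (f u) (g u)))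

    shift-fire : ∀ v → Shift (fireShift (toℕ v))
    shift-fire v D = fire m D v , (v , inj₁ (λ _ → refl)) ◅ ε , prefix-fire D v

    shift-unfire : ∀ v → Shift (λ u → - fireShift (toℕ v) u)
    shift-unfire v D = unfire D v , (v , inj₂ (λ w → sym (fire-unfire D v w))) ◅ ε , prefix-unfire D v

    shift-fireSet : ∀ i → i ℕ.≤ suc n → Shift (λ u → - cut i u)
    shift-fireSet zero    _     = shift-cong (λ u → cong -_ (sym (cut-zeroˡ u))) shift-zero
    shift-fireSet (suc i) i<1+n =
      shift-cong telescope (shift-+ (shift-fireSet i (ℕₚ.<⇒≤ i<1+n)) (shift-fire (fromℕ< i<1+n)))
      where
      telescope : ∀ u → - cut i u + fireShift (toℕ (fromℕ< i<1+n)) u ≡ - cut (suc i) u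
      telescope u rewrite Finₚ.toℕ-fromℕ< i<1+n = cancel (cut i u) (cut (suc i) u)
        where
        cancel : ∀ x y → - x + (x - y) ≡ - y
        cancel = solve-∀

    shift-unfireSet : ∀ i → i ℕ.≤ suc n → Shift (cut i)
    shift-unfireSet zero    _     = shift-cong (λ u → sym (cut-zeroˡ u)) shift-zero
    shift-unfireSet (suc i) i<1+n =
      shift-cong telescope (shift-+ (shift-unfireSet i (ℕₚ.<⇒≤ i<1+n)) (shift-unfire (fromℕ< i<1+n)))
      where
      telescope : ∀ u → cut i u + - fireShift (toℕ (fromℕ< i<1+n)) u ≡ cut (suc i) u
      telescope u rewrite Finₚ.toℕ-fromℕ< i<1+n = cancel (cut i u) (cut (suc i) u)
        where
        cancel : ∀ x y → x + - (x - y) ≡ y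
        cancel = solve-∀

    shift-ℕ* : ∀ {f} → Shift f → ∀ k → Shift (λ u → + k * f u)
    shift-ℕ* shift-f zero    = shift-zero
    shift-ℕ* {f} shift-f (suc k) = shift-cong (λ u → distrib (+ k) (f u)) (shift-+ shift-f (shift-ℕ* shift-f k))
      where
      distrib : ∀ k x → x + k * x ≡ (1ℤ + k) * x
      distrib = solve-∀

    shift-ℤ* : ∀ {f} → Shift f → Shift (λ u → - f u) → ∀ c → Shift (λ u → c * f u)
    shift-ℤ*     shift-f _      (+ k)     = shift-ℕ* shift-f k
    shift-ℤ* {f} _       shift-neg-f -[1+ k ] = shift-cong (λ u → swap-sign (+ suc k) (f u)) (shift-ℕ* shift-neg-f (suc k))
      where
      swap-sign : ∀ k x → k * - x ≡ (- k) * x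
      swap-sign = solve-∀

    shift-prefixSum : ∀ {f : ℕ → ℕ → ℤ} p → (∀ i → i ℕ.< p → Shift (f i)) →
                      Shift (λ u → prefixSum (λ i → f i u) p)
    shift-prefixSum zero    _       = shift-zero
    shift-prefixSum (suc p) shift-f =
      shift-+ (shift-prefixSum p (λ i i<p → shift-f i (ℕₚ.m<n⇒m<1+n i<p))) (shift-f p ℕₚ.≤-refl)

    shift-crossing : ∀ (c : ℕ → ℤ) → Shift (λ u → c u * + crossing u)
    shift-crossing c = shift-cong collapse (shift-prefixSum (suc n) shift-term)
      where
      shift-term : ∀ i → i ℕ.< suc n → Shift (λ u → c i * cut i u)
      shift-term i i<1+n = shift-ℤ* (shift-unfireSet i (ℕₚ.<⇒≤ i<1+n)) (shift-fireSet i (ℕₚ.<⇒≤ i<1+n)) (c i)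
      spike-form : ∀ u i → c i * cut i u ≡ spike u (c u * + crossing u) i
      spike-form u i with i ℕ.≟ u
      ... | yes refl = cong (c i *_) (cut-self refl)
      ... | no  i≢u  = trans (cong (c i *_) (cut-other (i≢u ∘ sym))) (ℤₚ.*-zeroʳ (c i))
      collapse : ∀ u → prefixSum (λ i → c i * cut i u) (suc n) ≡ c u * + crossing u
      collapse u = begin
        prefixSum (λ i → c i * cut i u) (suc n)         ≡⟨ prefixSum-cong (suc n) (λ i _ → spike-form u i) ⟩
        prefixSum (spike u (c u * + crossing u)) (suc n) ≡⟨ prefixSum-spike u _ (suc n) ⟩
        step u (c u * + crossing u) (suc n)              ≡⟨ step-saturated _ vanishes ⟩
        c u * + crossing u                               ∎
        where
        open ≡-Reasoning
        vanishes : suc n ℕ.≤ u → c u * + crossing u ≡ 0ℤ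
        vanishes N≤u = trans (cong (λ μ → c u * + μ) (crossing-beyond N≤u)) (ℤₚ.*-zeroʳ (c u))

    realize : ∀ {D M} → Admissible (prefix D) crossing M →
              Σ (Divisor n) λ D' → Equiv m D D' × Effective D' × (∀ u → prefix D' u ≡ M u)
    realize {D} {M} M-admissible =
      let D' , D~D' , prefix-D' = shift-crossing quotients D
          prefix-D'≗M : ∀ u → prefix D' u ≡ M u
          prefix-D'≗M u = trans (prefix-D' u) (reach u)
      in  D' , D~D' ,
          prefix-monotone⇒effective (λ u → subst₂ _≤_ (sym (prefix-D'≗M u)) (sym (prefix-D'≗M (suc u))) (monotone u)) ,
          prefix-D'≗M
      where
      open Admissible M-admissible
      quotients : ℕ → ℤ
      quotients u = quotient (_≡[mod_]_.∣difference (congruent u))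
      reach : ∀ u → prefix D u + quotients u * + crossing u ≡ M u
      reach u = trans (cong (_+_ (prefix D u)) (sym (_∣_.equality (_≡[mod_]_.∣difference (congruent u)))))
                      (cancel (prefix D u) (M u))
        where
        cancel : ∀ x y → x + (y - x) ≡ y
        cancel = solve-∀

    fireStep-congruent : ∀ {D D'} → FireStep m D D' → ∀ u → prefix D u ≡[mod crossing u ] prefix D' u
    fireStep-congruent {D} {D'} (v , inj₁ D'≗fire) u =
      ≡-mod-shift (trans (prefix-cong D'≗fire u) (prefix-fire D v u)) (crossing∣fireShift (toℕ v) u)
    fireStep-congruent {D} {D'} (v , inj₂ D≗fire) u =
      ≡-mod-sym (≡-mod-shift (trans (prefix-cong D≗fire u) (prefix-fire D' v u)) (crossing∣fireShift (toℕ v) u))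

    equiv-congruent : ∀ {D D'} → Equiv m D D' → ∀ u → prefix D u ≡[mod crossing u ] prefix D' u
    equiv-congruent = fold (λ D D' → ∀ u → prefix D u ≡[mod crossing u ] prefix D' u)
                           (λ step D'≡D'' u → ≡-mod-trans (fireStep-congruent step u) (D'≡D'' u))
                           (λ u → ≡-mod-refl _)

    unitDivisor : ℕ → Divisor n
    unitDivisor j w = spike j 1ℤ (toℕ w)

    pad-unitDivisor : ∀ {j} → j ℕ.≤ n → ∀ i → pad (unitDivisor j) i ≡ spike j 1ℤ i
    pad-unitDivisor {j} j≤n = pad-unique (spike j 1ℤ) (λ _ → refl)
      (λ i N≤i → spike-other 1ℤ (λ i≡j → ℕₚ.<⇒≱ (s≤s j≤n) (subst (suc n ℕ.≤_) i≡j N≤i)))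

    unitDivisor-effective : ∀ j → Effective (unitDivisor j)
    unitDivisor-effective j w with toℕ w ℕ.≟ j
    ... | yes _ = ℤ.+≤+ z≤n
    ... | no  _ = ℤ.+≤+ z≤n

    deg-unitDivisor : ∀ {j} → j ℕ.≤ n → deg (unitDivisor j) ≡ 1ℤ
    deg-unitDivisor {j} j≤n = begin
      deg (unitDivisor j)                  ≡⟨ deg-prefix (unitDivisor j) ⟩
      prefix (unitDivisor j) (suc n)       ≡⟨ prefixSum-cong (suc n) (λ i _ → pad-unitDivisor j≤n i) ⟩
      prefixSum (spike j 1ℤ) (suc n)       ≡⟨ prefixSum-spike j 1ℤ (suc n) ⟩
      step j 1ℤ (suc n)                    ≡⟨ step-< 1ℤ (s≤s j≤n) ⟩
      1ℤ                                   ∎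
      where open ≡-Reasoning

    rank-jump : ∀ {D} → RankAtLeast m D 1 → ∀ j → j ℕ.≤ n →
                Σ (ℕ → ℤ) λ R → Admissible (prefix D) crossing R × R j + 1ℤ ≤ R (suc j)
    rank-jump {D} rank j j≤n =
      let D₂ , D-χ~D₂ , D₂-effective = rank χ χ-effective (deg-unitDivisor j≤n)
          R : ℕ → ℤ
          R u = prefix D₂ u + prefix χ u
      in  R ,
          record
            { monotone  = λ u → ℤₚ.+-mono-≤ (effective⇒prefix-monotone D₂-effective u)
                                             (effective⇒prefix-monotone χ-effective u)
            ; congruent = λ u → ≡-mod-trans (≡-mod-reflexive (restore u))
                                             (≡-mod-+ʳ (prefix χ u) (equiv-congruent D-χ~D₂ u))
            } ,
          (begin
            prefix D₂ j + prefix χ j + 1ℤ          ≡⟨ regroup (prefix D₂ j) (prefix χ j) 1ℤ ⟩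
            prefix D₂ j + 0ℤ + (prefix χ j + 1ℤ)   ≤⟨ ℤₚ.+-mono-≤ (ℤₚ.+-monoʳ-≤ (prefix D₂ j) (pad-nonneg D₂-effective j))
                                                                 (ℤₚ.≤-reflexive (cong (_+_ (prefix χ j)) (sym χ-at-j))) ⟩
            R (suc j)                              ∎)
      where
      open ℤₚ.≤-Reasoning
      χ = unitDivisor j
      χ-effective = unitDivisor-effective j
      χ-at-j : pad χ j ≡ 1ℤ
      χ-at-j = trans (pad-unitDivisor j≤n j) (spike-self j 1ℤ)
      restore : ∀ u → prefix D u ≡ prefix (λ v → D v - χ v) u + prefix χ u
      restore u = trans (cancel (prefix D u) (prefix χ u)) (cong (_+ prefix χ u) (sym (prefix-sub D χ u)))
        where
        cancel : ∀ x y → x ≡ (x - y) + y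
        cancel = solve-∀
      regroup : ∀ x y z → x + y + z ≡ x + 0ℤ + (y + z)
      regroup = solve-∀

    crossing-periodic : ∀ {k ℓ s} .{{_ : NonZero s}} {a : Fin s → ℕ} →
      (∀ (e : Fin n) → k ℕ.≤ toℕ e → toℕ e ℕ.< k ℕ.+ ℓ → m e ≡ a ((toℕ e ℕ.∸ k) mod s)) →
      k ℕ.+ ℓ ℕ.≤ n → ∀ t → t ℕ.< ℓ → crossing (suc (t ℕ.+ k)) ≡ a (t mod s)
    crossing-periodic {k} {ℓ} {s} {a} periodic k+ℓ≤n t t<ℓ = begin
      crossing (suc (t ℕ.+ k))    ≡⟨ crossing-fromℕ< t+k<n ⟩
      m e                         ≡⟨ periodic e (subst (k ℕ.≤_) (sym toℕ-e) (ℕₚ.m≤n+m k t))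
                                                (subst (ℕ._< k ℕ.+ ℓ) (sym toℕ-e) t+k<k+ℓ) ⟩
      a ((toℕ e ℕ.∸ k) mod s)     ≡⟨ cong (λ i → a ((i ℕ.∸ k) mod s)) toℕ-e ⟩
      a ((t ℕ.+ k ℕ.∸ k) mod s)   ≡⟨ cong (λ i → a (i mod s)) (ℕₚ.m+n∸n≡m t k) ⟩
      a (t mod s)                 ∎
      where
      open ≡-Reasoning
      t+k<k+ℓ : t ℕ.+ k ℕ.< k ℕ.+ ℓ
      t+k<k+ℓ = subst (t ℕ.+ k ℕ.<_) (ℕₚ.+-comm ℓ k) (ℕₚ.+-monoˡ-< k t<ℓ)
      t+k<n : t ℕ.+ k ℕ.< n
      t+k<n = ℕₚ.<-≤-trans t+k<k+ℓ k+ℓ≤n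
      e : Fin n
      e = fromℕ< t+k<n
      toℕ-e : toℕ e ≡ t ℕ.+ k
      toℕ-e = Finₚ.toℕ-fromℕ< t+k<n

    lowest : Divisor n → ℕ → ℤ
    lowest D = greedy (prefix D) crossing

    highest : Divisor n → ℕ → ℤ
    highest D = greatest (suc n) (prefix D) crossing

    prefix-settled : ∀ D → Settled (suc n) (prefix D) crossing
    prefix-settled D u N≤u = crossing-beyond N≤u , prefix-stable D N≤u

    lowest-highest-congruent : ∀ D u → lowest D u ≡[mod crossing u ] highest D u
    lowest-highest-congruent D u =
      ≡-mod-trans (≡-mod-sym (greedy-congruent (prefix D) crossing u)) (greatest-congruent (prefix-settled D) u)

    module _ (D : Divisor n) (rank : RankAtLeast m D 1) where
      private
        R₀-admissible : Admissible (prefix D) crossing (proj₁ (rank-jump {D} rank 0 z≤n))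
        R₀-admissible = proj₁ (proj₂ (rank-jump {D} rank 0 z≤n))

      lowest-admissible : Admissible (prefix D) crossing (lowest D)
      lowest-admissible = greedy-admissible refl R₀-admissible

      highest-admissible : Admissible (prefix D) crossing (highest D)
      highest-admissible = greatest-admissible (prefix-settled D) R₀-admissible

      lowest≤highest : ∀ u → lowest D u ≤ highest D u
      lowest≤highest u =
        ℤₚ.≤-trans (greedy-least refl R₀-admissible u) (greatest-greatest (prefix-settled D) R₀-admissible u)

      lowest-highest-jump : ∀ j → j ℕ.≤ n → lowest D j + 1ℤ ≤ highest D (suc j)
      lowest-highest-jump j j≤n =
        let R , R-admissible , R-jump = rank-jump {D} rank j j≤n
        in  ℤₚ.≤-trans (ℤₚ.+-monoˡ-≤ 1ℤ (greedy-least refl R-admissible j))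
              (ℤₚ.≤-trans R-jump (greatest-greatest (prefix-settled D) R-admissible (suc j)))

      spliced-representative : ∀ k ℓ → k ℕ.+ ℓ ℕ.≤ n →
        Σ (Divisor n) λ D' → Equiv m D D' × Effective D' × (chipsOn D' k ℓ ≡ highest D (suc (ℓ ℕ.+ k)) - lowest D k)
      spliced-representative k ℓ k+ℓ≤n =
        let D' , D~D' , D'-effective , prefix-D' =
              realize (splice-admissible k lowest-admissible highest-admissible lowest≤highest)
        in  D' , D~D' , D'-effective , (begin
              chipsOn D' k ℓ                           ≡⟨ chipsOn-prefix D' {k} {ℓ} k+ℓ≤n ⟩
              prefix D' (suc (k ℕ.+ ℓ)) - prefix D' k  ≡⟨ cong₂ _-_ (prefix-D' (suc (k ℕ.+ ℓ))) (prefix-D' k) ⟩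
              M (suc (k ℕ.+ ℓ)) - M k                  ≡⟨ cong₂ _-_ (splice-> {k} {lowest D} {highest D} (s≤s (ℕₚ.m≤m+n k ℓ)))
                                                                    (splice-≤ {k} {lowest D} {highest D} ℕₚ.≤-refl) ⟩
              highest D (suc (k ℕ.+ ℓ)) - lowest D k   ≡⟨ cong (λ i → highest D (suc i) - lowest D k) (ℕₚ.+-comm k ℓ) ⟩
              highest D (suc (ℓ ℕ.+ k)) - lowest D k   ∎)
        where
        open ≡-Reasoning
        M = splice k (lowest D) (highest D)

open import Defs
open import Data.Nat using (ℕ; suc; _+_; _*_; _^_; _≤_; _<_; _∸_; NonZero)
open import Data.Nat.DivMod using (_mod_)
open import Data.Fin using (Fin; toℕ)
open import Data.Integer using (+_) renaming (_≤_ to _≤ℤ_)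
open import Data.Product using (Σ; _×_; _,_)
open import Relation.Binary.PropositionalEquality using (_≡_; subst; sym)
import Data.Nat.Properties as ℕₚ
import Data.Integer as ℤ
open IntegerSequences using (Admissible; _≡[mod_]_; gap-bound)
open BananaPaths using (module BananaPath)

lemma4p1 : (n : ℕ) (m : Fin n → ℕ) → (∀ i → 1 ≤ m i) →
    (k ℓ : ℕ) → k + ℓ ≤ n →
    (s : ℕ) .{{_ : NonZero s}} (a : Fin s → ℕ) → (∀ j → 1 ≤ a j) →
    (∀ (e : Fin n) → k ≤ toℕ e → toℕ e < k + ℓ → m e ≡ a ((toℕ e ∸ k) mod s)) →
    s * (lcmAll s a ^ 2) ≤ ℓ + 1 →
    (D : Divisor n) → RankAtLeast m D 1 →
    Σ (Divisor n) λ D' → Equiv m D D' × Effective D' × (+ lcmAll s a ≤ℤ chipsOn D' k ℓ)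
lemma4p1 n m _ k ℓ k+ℓ≤n s a _ periodic sL²≤ℓ+1 D rank =
  let D' , D~D' , D'-effective , chips = spliced-representative D rank k ℓ k+ℓ≤n
  in  D' , D~D' , D'-effective ,
      subst (+ lcmAll s a ≤ℤ_) (sym chips)
        (gap-bound a ℓ {x = λ t → lowest D (t + k)} {y = λ t → highest D (t + k)}
           (λ t → Admissible.monotone (lowest-admissible D rank) (t + k))
           (λ t → Admissible.monotone (highest-admissible D rank) (t + k))
           (λ t → lowest≤highest D rank (t + k))
           jump period sL²≤ℓ+1)
  where
  open BananaPath m
  jump : ∀ t → t ≤ ℓ → lowest D (t + k) ℤ.+ ℤ.1ℤ ≤ℤ highest D (suc (t + k))
  jump t t≤ℓ = lowest-highest-jump D rank (t + k)
                 (ℕₚ.≤-trans (ℕₚ.+-monoˡ-≤ k t≤ℓ) (subst (_≤ n) (ℕₚ.+-comm k ℓ) k+ℓ≤n))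
  period : ∀ t → t < ℓ → lowest D (suc (t + k)) ≡[mod a (t mod s) ] highest D (suc (t + k))
  period t t<ℓ = subst (λ μ → lowest D (suc (t + k)) ≡[mod μ ] highest D (suc (t + k)))
                   (crossing-periodic {a = a} periodic k+ℓ≤n t t<ℓ) (lowest-highest-congruent D (suc (t + k)))
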